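{- Let $S$ be a cap in $\Sigma=\mathrm{PG}(n,2)$ with the notation of the context, and suppose $2\leq r\leq n-1$, that $\widehat C\setminus C$ is a single point $\{c_0\}$, that $A(i)+C=B'(i)$ and $B(i)+C=A'(i)$ for all $i$, and that $|A(i)|=|B(i)|=1$ for all $i=1,2,\dots,2^{n-r-1}$. Then $S$ is a complete cap if and only if $A\oplus A=H_\infty\setminus F$.
   Context: Points of $\mathrm{PG}(n,2)$ are the nonzero vectors of $\mathbb{F}_2^{n+1}$; three distinct points $x,y,z$ are collinear iff $x+y=z$. A cap is a set with no three collinear points; complete if not properly contained in another cap. $X\oplus Y=\{x+y:x\in X,y\in Y,x\ne y\}$; for disjoint $X,Y$ also $X+Y=X\oplus Y$. Setting: $H_\infty$ is a codimension-2 subspace of $\Sigma$ disjoint from $S$; $K_A,K_B,K_C$ are the three hyperplanes containing it; $H_X=K_X\setminus H_\infty$; $A=S\cap H_A$, $B=S\cap H_B$, $C=S\cap H_C\neq\emptyset$. $\widetilde F$ is the projective subspace spanned by $C$, of projective dimension $r$; $F=\widetilde F\cap H_\infty$; $W=F\cup\{0\}$ (a linear subspace of dimension $r$); $\widehat C=\widetilde F\setminus F$. $H_A$ is partitioned into the $2^{n-r-1}$ cosets $H_A(i)=a+W$ ($a\in H_A$); $H_B(i)=c+H_A(i)$ for any $c\in\widehat C$. $A(i)=A\cap H_A(i)$, $A'(i)=H_A(i)\setminus A(i)$, $B(i)=B\cap H_B(i)$, $B'(i)=H_B(i)\setminus B(i)$. -}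

module Defs where

open import Data.Bool using (Bool; true; false; _xor_; _∧_; T; if_then_else_)
open import Data.Nat using (ℕ; suc)
open import Data.Vec using (Vec; zipWith; replicate; foldr; _∷_; [])
open import Data.Product using (Σ; ∃; _×_; _,_)
open import Data.Sum using (_⊎_)
open import Relation.Binary.PropositionalEquality using (_≡_; _≢_)
open import Relation.Nullary using (¬_)
open import Function.Bundles using (_⇔_)

-- The vector space F_2^{n+1}; points of PG(n,2) are its nonzero vectors.

Vect : ℕ → Set
Vect n = Vec Bool (suc n)

infixl 6 _⊹_
_⊹_ : ∀ {n} → Vect n → Vect n → Vect n
x ⊹ y = zipWith _xor_ x y

0v : ∀ {n} → Vect n
0v = replicate _ false

dot : ∀ {m} → Vec Bool m → Vec Bool m → Bool
dot u x = foldr _ _xor_ false (zipWith _∧_ u x)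

_∈_ : ∀ {n} → Vect n → (Vect n → Bool) → Set
x ∈ S = T (S x)

_⊆_ : ∀ {n} → (Vect n → Bool) → (Vect n → Bool) → Set
S ⊆ S' = ∀ x → x ∈ S → x ∈ S'

-- A cap: a set of points with no three distinct collinear points
-- (x, y, z distinct are collinear iff x + y = z).
IsCap : ∀ {n} → (Vect n → Bool) → Set
IsCap S = (∀ x → x ∈ S → x ≢ 0v)
        × (∀ x y z → x ∈ S → y ∈ S → z ∈ S →
             x ≢ y → y ≢ z → x ≢ z → x ⊹ y ≢ z)

IsCompleteCap : ∀ {n} → (Vect n → Bool) → Set
IsCompleteCap S = IsCap S × (∀ S' → IsCap S' → S ⊆ S' → S' ⊆ S)

data Span {n} (P : Vect n → Set) : Vect n → Set where
  span-0   : Span P 0v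
  span-inc : ∀ {x} → P x → Span P x
  span-add : ∀ {x y} → Span P x → Span P y → Span P (x ⊹ y)

lincomb : ∀ {n k} → Vec (Vect n) k → Vec Bool k → Vect n
lincomb []       []       = 0v
lincomb (b ∷ bs) (c ∷ cs) = (if c then b else 0v) ⊹ lincomb bs cs

HasDim : ∀ {n} → (Vect n → Set) → ℕ → Set
HasDim {n} U d =
  Σ (Vec (Vect n) d) λ b →
    (∀ c → lincomb b c ≡ 0v → c ≡ replicate d false)
    × (∀ x → U x ⇔ (∃ λ c → lincomb b c ≡ x))

_⊕_ : ∀ {n} → (Vect n → Set) → (Vect n → Set) → Vect n → Set
(X ⊕ Y) z = ∃ λ x → ∃ λ y → X x × Y y × x ≢ y × z ≡ x ⊹ y

ExactlyOne : ∀ {n} → (Vect n → Set) → Set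
ExactlyOne P = ∃ λ x → P x × (∀ y → P y → y ≡ x)

-- H_∞ = ker φ₁ ∩ ker φ₂ (projective points) where
-- φᵢ = dot uᵢ, with u₁, u₂ linearly independent (nonzero, distinct).
-- The three hyperplanes through H_∞ are labelled
--   H_A = {φ₁ = 1, φ₂ = 0}, H_B = {φ₁ = 0, φ₂ = 1}, H_C = {φ₁ = 1, φ₂ = 1}
-- (every labelling of the three hyperplanes arises from some choice of u₁, u₂).

module Setting {n : ℕ} (u₁ u₂ : Vect n) (S : Vect n → Bool) (c₀ : Vect n) where

  H∞ : Vect n → Set
  H∞ x = dot u₁ x ≡ false × dot u₂ x ≡ false × x ≢ 0v

  HA HB HC : Vect n → Set
  HA x = dot u₁ x ≡ true  × dot u₂ x ≡ false
  HB x = dot u₁ x ≡ false × dot u₂ x ≡ true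
  HC x = dot u₁ x ≡ true  × dot u₂ x ≡ true

  A B C : Vect n → Set
  A x = x ∈ S × HA x
  B x = x ∈ S × HB x
  C x = x ∈ S × HC x

  F̃ : Vect n → Set
  F̃ x = Span C x × x ≢ 0v

  F : Vect n → Set
  F x = F̃ x × H∞ x

  W : Vect n → Set
  W x = F x ⊎ x ≡ 0v

  Ĉ : Vect n → Set
  Ĉ x = F̃ x × ¬ F x

  -- coset H_A(i) = a + W, for a representative a ∈ H_A
  HAᵢ : Vect n → Vect n → Set
  HAᵢ a x = ∃ λ w → W w × x ≡ a ⊹ w

  -- H_B(i) = c + H_A(i), c ∈ Ĉ (here c = c₀ ∈ Ĉ)
  HBᵢ : Vect n → Vect n → Set
  HBᵢ a x = ∃ λ y → HAᵢ a y × x ≡ c₀ ⊹ y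

  Aᵢ A'ᵢ Bᵢ B'ᵢ : Vect n → Vect n → Set
  Aᵢ  a x = A x × HAᵢ a x
  A'ᵢ a x = HAᵢ a x × ¬ A x
  Bᵢ  a x = B x × HBᵢ a x
  B'ᵢ a x = HBᵢ a x × ¬ B x

module Submission where

-- The point c₀ of Ĉ ∖ C lies in H_C, and the coset conditions force c₀ + A ⊆ B, c₀ + B ⊆ A and
-- one point of A per coset of W; so A ⊕ A ⊆ H∞ ∖ F always.  A cap is complete iff every point
-- off it lies on a secant.  If S is complete, a point x of H∞ ∖ F lies on a secant {s, s + x};
-- s cannot lie in H_C (else x ∈ F), so after translating by c₀ when s ∈ B this is a pair of A.
-- Conversely, if A ⊕ A = H∞ ∖ F, points of H_A ∖ S and H_B ∖ S lie on secants by the coset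
-- conditions, points of H∞ ∖ F and of H_C ∖ ⟨C⟩ by A ⊕ A = H∞ ∖ F (translating by c₀),
-- c₀ = (c₀ + e) + e for e ∈ A, and a point y of F on no secant would force C = {y + c₀},
-- contradicting dim ⟨C⟩ ≥ 2.

open import Defs
open import Algebra using (CommutativeRing)
open import Data.Nat using (ℕ; suc; zero; _≤_; _∸_; s≤s)
open import Data.Bool using (Bool; true; false; _xor_; _∧_; _∨_; if_then_else_)
open import Data.Bool.Properties
  using (xor-assoc; xor-comm; xor-identityˡ; xor-identityʳ; xor-same; ∧-comm; ∧-distribˡ-xor;
         xor-∧-commutativeRing; T-∨)
  renaming (_≟_ to _≟ᵇ_)
open import Algebra.Properties.CommutativeSemigroup
  (CommutativeRing.+-commutativeSemigroup xor-∧-commutativeRing) using (interchange)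
open import Data.Vec using (Vec; _∷_; []; replicate; zipWith; foldr)
open import Data.Vec.Properties
  using (≡-dec; zipWith-comm; zipWith-assoc; zipWith-identityˡ; zipWith-identityʳ; zipWith-inverseˡ; map-id)
open import Data.Product using (∃; _×_; _,_; proj₁; proj₂)
open import Data.Sum using (_⊎_; inj₁; inj₂; [_,_]; map₂)
open import Function using (_∘_)
open import Relation.Binary.PropositionalEquality
  using (_≡_; _≢_; refl; sym; trans; cong; cong₂; subst; module ≡-Reasoning)
open import Relation.Nullary using (¬_; Dec; yes; no; contradiction; ¬¬-excluded-middle)
open import Relation.Nullary.Decidable
  using (T?; map′; _⊎-dec_; _×-dec_; decidable-stable; toWitness; fromWitness; ⌊_⌋)
open import Function.Bundles using (_⇔_; Equivalence; mk⇔)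

⊹-comm : ∀ {n} (x y : Vect n) → x ⊹ y ≡ y ⊹ x
⊹-comm = zipWith-comm xor-comm

⊹-assoc : ∀ {n} (x y z : Vect n) → (x ⊹ y) ⊹ z ≡ x ⊹ (y ⊹ z)
⊹-assoc = zipWith-assoc xor-assoc

⊹-identityˡ : ∀ {n} (x : Vect n) → 0v ⊹ x ≡ x
⊹-identityˡ = zipWith-identityˡ xor-identityˡ

⊹-identityʳ : ∀ {n} (x : Vect n) → x ⊹ 0v ≡ x
⊹-identityʳ = zipWith-identityʳ xor-identityʳ

⊹-self : ∀ {n} (x : Vect n) → x ⊹ x ≡ 0v
⊹-self x = trans (cong (_⊹ x) (sym (map-id x))) (zipWith-inverseˡ xor-same x)

x⊹[x⊹y]≡y : ∀ {n} (x y : Vect n) → x ⊹ (x ⊹ y) ≡ y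
x⊹[x⊹y]≡y x y = begin
  x ⊹ (x ⊹ y)  ≡⟨ ⊹-assoc x x y ⟨
  (x ⊹ x) ⊹ y  ≡⟨ cong (_⊹ y) (⊹-self x) ⟩
  0v ⊹ y       ≡⟨ ⊹-identityˡ y ⟩
  y            ∎
  where open ≡-Reasoning

[x⊹y]⊹y≡x : ∀ {n} (x y : Vect n) → (x ⊹ y) ⊹ y ≡ x
[x⊹y]⊹y≡x x y = begin
  (x ⊹ y) ⊹ y  ≡⟨ ⊹-assoc x y y ⟩
  x ⊹ (y ⊹ y)  ≡⟨ cong (x ⊹_) (⊹-self y) ⟩
  x ⊹ 0v       ≡⟨ ⊹-identityʳ x ⟩
  x            ∎
  where open ≡-Reasoning

x⊹y≡z⇒y≡x⊹z : ∀ {n} {x y z : Vect n} → x ⊹ y ≡ z → y ≡ x ⊹ z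
x⊹y≡z⇒y≡x⊹z {x = x} {y} eq = trans (sym (x⊹[x⊹y]≡y x y)) (cong (x ⊹_) eq)

⊹-cancelˡ : ∀ {n} (x : Vect n) {y z} → x ⊹ y ≡ x ⊹ z → y ≡ z
⊹-cancelˡ x {z = z} eq = trans (x⊹y≡z⇒y≡x⊹z eq) (x⊹[x⊹y]≡y x z)

x⊹y≡0⇒x≡y : ∀ {n} {x y : Vect n} → x ⊹ y ≡ 0v → x ≡ y
x⊹y≡0⇒x≡y {x = x} eq = sym (trans (x⊹y≡z⇒y≡x⊹z eq) (⊹-identityʳ x))

x≢0⇒y≢y⊹x : ∀ {n} {x : Vect n} → x ≢ 0v → ∀ y → y ≢ y ⊹ x
x≢0⇒y≢y⊹x x≢0 y y≡y⊹x = x≢0 (sym (⊹-cancelˡ y (trans (⊹-identityʳ y) y≡y⊹x)))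

dot-0ʳ : ∀ {m} (u : Vec Bool m) → dot u (replicate m false) ≡ false
dot-0ʳ []          = refl
dot-0ʳ (true ∷ u)  = dot-0ʳ u
dot-0ʳ (false ∷ u) = dot-0ʳ u

dot-comm : ∀ {m} (u x : Vec Bool m) → dot u x ≡ dot x u
dot-comm u x = cong (foldr _ _xor_ false) (zipWith-comm ∧-comm u x)

dot-⊹ʳ : ∀ {m} (u x y : Vec Bool m) → dot u (zipWith _xor_ x y) ≡ dot u x xor dot u y
dot-⊹ʳ []      []      []      = refl
dot-⊹ʳ (p ∷ u) (a ∷ x) (b ∷ y) = begin
  (p ∧ (a xor b)) xor dot u (zipWith _xor_ x y)     ≡⟨ cong₂ _xor_ (∧-distribˡ-xor p a b) (dot-⊹ʳ u x y) ⟩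
  ((p ∧ a) xor (p ∧ b)) xor (dot u x xor dot u y)  ≡⟨ interchange (p ∧ a) (p ∧ b) (dot u x) (dot u y) ⟩
  ((p ∧ a) xor dot u x) xor ((p ∧ b) xor dot u y)  ∎
  where open ≡-Reasoning

dot-⊹ˡ : ∀ {m} (u v x : Vec Bool m) → dot (zipWith _xor_ u v) x ≡ dot u x xor dot v x
dot-⊹ˡ u v x = begin
  dot (zipWith _xor_ u v) x  ≡⟨ dot-comm (zipWith _xor_ u v) x ⟩
  dot x (zipWith _xor_ u v)  ≡⟨ dot-⊹ʳ x u v ⟩
  dot x u xor dot x v        ≡⟨ cong₂ _xor_ (dot-comm x u) (dot-comm x v) ⟩
  dot u x xor dot v x        ∎
  where open ≡-Reasoning

dot-⊹ : ∀ {m} (u : Vec Bool m) {x y p q} → dot u x ≡ p → dot u y ≡ q → dot u (zipWith _xor_ x y) ≡ p xor q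
dot-⊹ u {x} {y} refl refl = dot-⊹ʳ u x y

dot-nonzero : ∀ {m} (u : Vec Bool m) → u ≢ replicate m false → ∃ λ x → dot u x ≡ true
dot-nonzero []          u≢0 = contradiction refl u≢0
dot-nonzero (true ∷ u)  _   = true ∷ replicate _ false , cong (true xor_) (dot-0ʳ u)
dot-nonzero (false ∷ u) u≢0 with dot-nonzero u (u≢0 ∘ cong (false ∷_))
... | x , ux = false ∷ x , ux

dot-separates : ∀ {n} (u v : Vect n) → u ≢ 0v → u ≢ v → ∃ λ x → dot u x ≡ true × dot v x ≡ false
dot-separates u v u≢0 u≢v
  with dot-nonzero u u≢0 | dot-nonzero (u ⊹ v) (u≢v ∘ x⊹y≡0⇒x≡y)
... | x , ux | y , [u⊹v]y with dot v x in vx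
...   | false = x , ux , vx
...   | true with dot u y in uy | dot v y in vy | trans (sym (dot-⊹ˡ u v y)) [u⊹v]y
...     | true  | false | _ = y , uy , vy
...     | false | true  | _ = x ⊹ y , dot-⊹ u ux uy , dot-⊹ v vx vy
...     | true  | true  | ()
...     | false | false | ()

Span-dot≡ : ∀ {n} {P : Vect n → Set} (u v : Vect n) →
  (∀ {x} → P x → dot u x ≡ dot v x) → ∀ {x} → Span P x → dot u x ≡ dot v x
Span-dot≡ u v P-dot≡ span-0                    = trans (dot-0ʳ u) (sym (dot-0ʳ v))
Span-dot≡ u v P-dot≡ (span-inc p)              = P-dot≡ p
Span-dot≡ u v P-dot≡ (span-add {x} {y} p q) =
  trans (dot-⊹ u (Span-dot≡ u v P-dot≡ p) (Span-dot≡ u v P-dot≡ q)) (sym (dot-⊹ʳ v x y))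

Span-⊆-pair : ∀ {n} {P : Vect n → Set} {c} → (∀ {x} → P x → x ≡ c) → ∀ {x} → Span P x → x ≡ 0v ⊎ x ≡ c
Span-⊆-pair P≡c span-0       = inj₁ refl
Span-⊆-pair P≡c (span-inc p) = inj₂ (P≡c p)
Span-⊆-pair {c = c} P≡c (span-add p q) with Span-⊆-pair P≡c p | Span-⊆-pair P≡c q
... | inj₁ refl | inj₁ refl = inj₁ (⊹-self 0v)
... | inj₁ refl | inj₂ refl = inj₂ (⊹-identityˡ c)
... | inj₂ refl | inj₁ refl = inj₂ (⊹-identityʳ c)
... | inj₂ refl | inj₂ refl = inj₁ (⊹-self c)

lincomb-zeros : ∀ {n k} (bs : Vec (Vect n) k) → lincomb bs (replicate k false) ≡ 0v
lincomb-zeros []       = refl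
lincomb-zeros (b ∷ bs) = trans (⊹-identityˡ _) (lincomb-zeros bs)

HasDim-¬⊆pair : ∀ {n k} {P : Vect n → Set} {c} →
  HasDim P (suc (suc k)) → ¬ (∀ {x} → P x → x ≡ 0v ⊎ x ≡ c)
HasDim-¬⊆pair {k = k} {c = c} (b₀ ∷ b₁ ∷ bs , independent , spans) P⊆pair =
  contradiction (independent (true ∷ true ∷ zeros) b₀⊹b₁≡0) λ ()
  where
  zeros : Vec Bool k
  zeros = replicate k false

  combination : ∀ p q → lincomb (b₀ ∷ b₁ ∷ bs) (p ∷ q ∷ zeros)
                          ≡ (if p then b₀ else 0v) ⊹ (if q then b₁ else 0v)
  combination p q = trans (cong (λ v → (if p then b₀ else 0v) ⊹ ((if q then b₁ else 0v) ⊹ v))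
                               (lincomb-zeros bs))
                          (cong (_ ⊹_) (⊹-identityʳ _))

  member≡c : ∀ {x} cs → cs ≢ replicate _ false → lincomb (b₀ ∷ b₁ ∷ bs) cs ≡ x → x ≡ c
  member≡c cs cs≢0 eq with P⊆pair (Equivalence.from (spans _) (cs , eq))
  ... | inj₁ x≡0 = contradiction (independent cs (trans eq x≡0)) cs≢0
  ... | inj₂ x≡c = x≡c

  b₀⊹b₁≡0 : lincomb (b₀ ∷ b₁ ∷ bs) (true ∷ true ∷ zeros) ≡ 0v
  b₀⊹b₁≡0 = begin
    lincomb (b₀ ∷ b₁ ∷ bs) (true ∷ true ∷ zeros)  ≡⟨ combination true true ⟩
    b₀ ⊹ b₁                                       ≡⟨ cong₂ _⊹_ b₀≡c b₁≡c ⟩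
    c ⊹ c                                         ≡⟨ ⊹-self c ⟩
    0v                                            ∎
    where
    open ≡-Reasoning
    b₀≡c : b₀ ≡ c
    b₀≡c = member≡c (true ∷ false ∷ zeros) (λ ()) (trans (combination true false) (⊹-identityʳ b₀))
    b₁≡c : b₁ ≡ c
    b₁≡c = member≡c (false ∷ true ∷ zeros) (λ ()) (trans (combination false true) (⊹-identityˡ b₁))

OffSecants : ∀ {n} → (Vect n → Bool) → Vect n → Set
OffSecants S y = ∀ s t → s ∈ S → t ∈ S → s ≢ t → s ⊹ t ≢ y

⊕⇒¬OffSecants : ∀ {n} {S : Vect n → Bool} {P Q : Vect n → Set} {y} →
  (∀ {x} → P x → x ∈ S) → (∀ {x} → Q x → x ∈ S) → (P ⊕ Q) y → ¬ OffSecants S y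
⊕⇒¬OffSecants P⊆S Q⊆S (s , t , Ps , Qt , s≢t , y≡s⊹t) off = off s t (P⊆S Ps) (Q⊆S Qt) s≢t (sym y≡s⊹t)

insert : ∀ {n} → Vect n → (Vect n → Bool) → Vect n → Bool
insert y S x = S x ∨ ⌊ ≡-dec _≟ᵇ_ x y ⌋

module _ {n} {y : Vect n} {S : Vect n → Bool} where

  ∈-insert⁻ : ∀ {x} → x ∈ insert y S → x ∈ S ⊎ x ≡ y
  ∈-insert⁻ {x} x∈ = map₂ (toWitness {a? = ≡-dec _≟ᵇ_ x y}) (Equivalence.to T-∨ x∈)

  ∈-insertˡ : y ∈ insert y S
  ∈-insertˡ = Equivalence.from T-∨ (inj₂ (fromWitness {a? = ≡-dec _≟ᵇ_ y y} refl))

  ∈-insertʳ : S ⊆ insert y S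
  ∈-insertʳ _ x∈S = Equivalence.from T-∨ (inj₁ x∈S)

  IsCap-insert : IsCap S → y ≢ 0v → OffSecants S y → IsCap (insert y S)
  IsCap-insert (S≢0 , S-noLine) y≢0 off = nonzero , noLine
    where
    nonzero : ∀ x → x ∈ insert y S → x ≢ 0v
    nonzero x x∈ with ∈-insert⁻ x∈
    ... | inj₁ x∈S = S≢0 x x∈S
    ... | inj₂ refl = y≢0

    noLine : ∀ x₁ x₂ x₃ → x₁ ∈ insert y S → x₂ ∈ insert y S → x₃ ∈ insert y S →
             x₁ ≢ x₂ → x₂ ≢ x₃ → x₁ ≢ x₃ → x₁ ⊹ x₂ ≢ x₃
    noLine x₁ x₂ x₃ p₁ p₂ p₃ x₁≢x₂ x₂≢x₃ x₁≢x₃ with ∈-insert⁻ p₁ | ∈-insert⁻ p₂ | ∈-insert⁻ p₃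
    ... | inj₁ s₁   | inj₁ s₂   | inj₁ s₃   = S-noLine x₁ x₂ x₃ s₁ s₂ s₃ x₁≢x₂ x₂≢x₃ x₁≢x₃
    ... | inj₁ s₁   | inj₁ s₂   | inj₂ refl = off x₁ x₂ s₁ s₂ x₁≢x₂
    ... | inj₁ s₁   | inj₂ refl | inj₁ s₃   = off x₁ x₃ s₁ s₃ x₁≢x₃ ∘ sym ∘ x⊹y≡z⇒y≡x⊹z
    ... | inj₂ refl | inj₁ s₂   | inj₁ s₃   =
      off x₂ x₃ s₂ s₃ x₂≢x₃ ∘ sym ∘ x⊹y≡z⇒y≡x⊹z ∘ trans (⊹-comm x₂ y)
    ... | inj₂ refl | inj₂ refl | _         = contradiction refl x₁≢x₂
    ... | inj₂ refl | _         | inj₂ refl = contradiction refl x₁≢x₃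
    ... | _         | inj₂ refl | inj₂ refl = contradiction refl x₂≢x₃

∃-Vec? : ∀ {m} {P : Vec Bool m → Set} → (∀ v → Dec (P v)) → Dec (∃ P)
∃-Vec? {zero}      P? = map′ ([] ,_) (λ { ([] , p) → p }) (P? [])
∃-Vec? {suc m} {P} P? =
  map′ [ (λ (v , p) → true ∷ v , p) , (λ (v , p) → false ∷ v , p) ] byHead
       (∃-Vec? (P? ∘ (true ∷_)) ⊎-dec ∃-Vec? (P? ∘ (false ∷_)))
  where
  byHead : ∃ P → ∃ (P ∘ (true ∷_)) ⊎ ∃ (P ∘ (false ∷_))
  byHead (true ∷ v , p)  = inj₁ (v , p)
  byHead (false ∷ v , p) = inj₂ (v , p)

module _ {n} {S : Vect n → Bool} where

  complete⇒secant : IsCompleteCap S → ∀ {y} → y ≢ 0v → ¬ y ∈ S → ∃ λ s → s ∈ S × (s ⊹ y) ∈ S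
  complete⇒secant (capS , maximal) {y} y≢0 y∉S =
    decidable-stable (∃-Vec? λ s → T? (S s) ×-dec T? (S (s ⊹ y))) λ no-secant →
      y∉S (maximal (insert y S) (IsCap-insert capS y≢0 (off no-secant)) ∈-insertʳ y (∈-insertˡ {S = S}))
    where
    off : ¬ (∃ λ s → s ∈ S × (s ⊹ y) ∈ S) → OffSecants S y
    off no-secant s t s∈S t∈S _ s⊹t≡y = no-secant (s , s∈S , subst (_∈ S) (x⊹y≡z⇒y≡x⊹z s⊹t≡y) t∈S)

  secants⇒complete : IsCap S → (∀ y → y ≢ 0v → ¬ y ∈ S → ¬ OffSecants S y) → IsCompleteCap S
  secants⇒complete capS covered = capS , λ S' (S'≢0 , S'-noLine) S⊆S' y y∈S' →
    decidable-stable (T? (S y)) λ y∉S → covered y (S'≢0 y y∈S') y∉S λ s t s∈S t∈S s≢t →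
      S'-noLine s t y (S⊆S' s s∈S) (S⊆S' t t∈S) y∈S' s≢t
        (λ t≡y → y∉S (subst (_∈ S) t≡y t∈S)) (λ s≡y → y∉S (subst (_∈ S) s≡y s∈S))

module _ {n} (u₁ u₂ : Vect n) (S : Vect n → Bool) (c₀ : Vect n) where
  open Setting u₁ u₂ S c₀

  CosetConditions : Vect n → Set
  CosetConditions a = (∀ x → (Aᵢ a ⊕ C) x ⇔ B'ᵢ a x)
                    × (∀ x → (Bᵢ a ⊕ C) x ⇔ A'ᵢ a x)
                    × ExactlyOne (Aᵢ a)
                    × ExactlyOne (Bᵢ a)

module Configuration {n} (u₁ u₂ : Vect n) (S : Vect n → Bool) (c₀ : Vect n)
  (capS : IsCap S)
  (S∩H∞≡∅ : ∀ x → x ∈ S → ¬ Setting.H∞ u₁ u₂ S c₀ x)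
  (Ĉ∖C≡c₀ : ∀ x → (Setting.Ĉ u₁ u₂ S c₀ x × ¬ Setting.C u₁ u₂ S c₀ x) ⇔ (x ≡ c₀))
  (cosets : ∀ a → Setting.HA u₁ u₂ S c₀ a → CosetConditions u₁ u₂ S c₀ a)
  where

  open Setting u₁ u₂ S c₀

  Φ : Vect n → Bool → Bool → Set
  Φ x p q = dot u₁ x ≡ p × dot u₂ x ≡ q

  Φ-⊹ : ∀ {x y p q p' q'} → Φ x p q → Φ y p' q' → Φ (x ⊹ y) (p xor p') (q xor q')
  Φ-⊹ (ux , vx) (uy , vy) = dot-⊹ u₁ ux uy , dot-⊹ u₂ vx vy

  data Position (x : Vect n) : Set where
    in-H∞∪0 : Φ x false false → Position x
    in-HA : HA x → Position x
    in-HB : HB x → Position x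
    in-HC : HC x → Position x

  position : ∀ x → Position x
  position x with dot u₁ x in ux | dot u₂ x in vx
  ... | false | false = in-H∞∪0 (ux , vx)
  ... | true  | false = in-HA (ux , vx)
  ... | false | true  = in-HB (ux , vx)
  ... | true  | true  = in-HC (ux , vx)

  HB-HA-distinct : ∀ {x y} → HB x → HA y → x ≢ y
  HB-HA-distinct (ux , _) (uy , _) refl = contradiction (trans (sym uy) ux) λ ()

  HC⇒≢0 : ∀ {x} → HC x → x ≢ 0v
  HC⇒≢0 (ux , _) refl = contradiction (trans (sym ux) (dot-0ʳ u₁)) λ ()

  HC⇒∉F : ∀ {x} → HC x → ¬ F x
  HC⇒∉F (ux , _) (_ , ux' , _) = contradiction (trans (sym ux) ux') λ ()

  c₀∈Ĉ∖C : Ĉ c₀ × ¬ C c₀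
  c₀∈Ĉ∖C = Equivalence.from (Ĉ∖C≡c₀ c₀) refl

  c₀∈SpanC : Span C c₀
  c₀∈SpanC = proj₁ (proj₁ (proj₁ c₀∈Ĉ∖C))

  c₀≢0 : c₀ ≢ 0v
  c₀≢0 = proj₂ (proj₁ (proj₁ c₀∈Ĉ∖C))

  c₀∉F : ¬ F c₀
  c₀∉F = proj₂ (proj₁ c₀∈Ĉ∖C)

  c₀∉C : ¬ C c₀
  c₀∉C = proj₂ c₀∈Ĉ∖C

  c₀∈HC : HC c₀
  c₀∈HC with position c₀ | Span-dot≡ u₁ u₂ (λ (_ , uc , vc) → trans uc (sym vc)) c₀∈SpanC
  ... | in-H∞∪0 (u , v) | _ = contradiction ((c₀∈SpanC , c₀≢0) , u , v , c₀≢0) c₀∉F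
  ... | in-HA (u , v) | u≡v = contradiction (trans (sym u) (trans u≡v v)) λ ()
  ... | in-HB (u , v) | u≡v = contradiction (trans (sym v) (trans (sym u≡v) u)) λ ()
  ... | in-HC h       | _   = h

  HAᵢ-refl : ∀ a → HAᵢ a a
  HAᵢ-refl a = 0v , inj₂ refl , sym (⊹-identityʳ a)

  module _ {a} (ha : HA a) where

    Aᵢ⊕C⇔B'ᵢ : ∀ x → (Aᵢ a ⊕ C) x ⇔ B'ᵢ a x
    Aᵢ⊕C⇔B'ᵢ = proj₁ (cosets a ha)

    Bᵢ⊕C⇔A'ᵢ : ∀ x → (Bᵢ a ⊕ C) x ⇔ A'ᵢ a x
    Bᵢ⊕C⇔A'ᵢ = proj₁ (proj₂ (cosets a ha))

    Aᵢ-inhabited : ∃ (Aᵢ a)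
    Aᵢ-inhabited = let x , Ax , _ = proj₁ (proj₂ (proj₂ (cosets a ha))) in x , Ax

    Aᵢ-unique : ∀ {x y} → Aᵢ a x → Aᵢ a y → x ≡ y
    Aᵢ-unique Ax Ay = let _ , _ , unique = proj₁ (proj₂ (proj₂ (cosets a ha)))
                      in trans (unique _ Ax) (sym (unique _ Ay))

    Bᵢ-unique : ∀ {x y} → Bᵢ a x → Bᵢ a y → x ≡ y
    Bᵢ-unique Bx By = let _ , _ , unique = proj₂ (proj₂ (proj₂ (cosets a ha)))
                      in trans (unique _ Bx) (sym (unique _ By))

  x⊹c≢c₀⊹x : ∀ {x c} → C c → x ⊹ c ≢ c₀ ⊹ x
  x⊹c≢c₀⊹x {x} {c} c∈C eq =
    c₀∉C (subst C (⊹-cancelˡ x (trans eq (⊹-comm c₀ x))) c∈C)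

  c₀⊹A⊆B : ∀ {a} → A a → B (c₀ ⊹ a)
  c₀⊹A⊆B {a} a∈A@(_ , ha) = decidable-stable (T? (S (c₀ ⊹ a))) c₀⊹a∈S , Φ-⊹ c₀∈HC ha
    where
    c₀⊹a∈S : ¬ ¬ (c₀ ⊹ a) ∈ S
    c₀⊹a∈S c₀⊹a∉S
      with Equivalence.from (Aᵢ⊕C⇔B'ᵢ ha (c₀ ⊹ a)) ((a , HAᵢ-refl a , refl) , c₀⊹a∉S ∘ proj₁)
    ... | s , c , s∈Aᵢ , c∈C , _ , c₀⊹a≡s⊹c
      rewrite Aᵢ-unique ha s∈Aᵢ (a∈A , HAᵢ-refl a) = x⊹c≢c₀⊹x c∈C (sym c₀⊹a≡s⊹c)

  c₀⊹B⊆A : ∀ {b} → B b → A (c₀ ⊹ b)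
  c₀⊹B⊆A {b} b∈B@(_ , hb) = decidable-stable (T? (S a)) a∈S , ha
    where
    a : Vect n
    a = c₀ ⊹ b
    ha : HA a
    ha = Φ-⊹ c₀∈HC hb
    a∈S : ¬ ¬ a ∈ S
    a∈S a∉S with Equivalence.from (Bᵢ⊕C⇔A'ᵢ ha a) (HAᵢ-refl a , a∉S ∘ proj₁)
    ... | b' , c , b'∈Bᵢ , c∈C , _ , a≡b'⊹c
      rewrite Bᵢ-unique ha b'∈Bᵢ (b∈B , a , HAᵢ-refl a , sym (x⊹[x⊹y]≡y c₀ b)) =
        x⊹c≢c₀⊹x c∈C (sym a≡b'⊹c)

  A⊕A⊆H∞∖F : ∀ {x} → (A ⊕ A) x → H∞ x × ¬ F x
  A⊕A⊆H∞∖F (a , a' , a∈A@(_ , ha) , a'∈A@(_ , ha') , a≢a' , refl) =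
    (proj₁ Φ[a⊹a'] , proj₂ Φ[a⊹a'] , a≢a' ∘ x⊹y≡0⇒x≡y) ,
    λ a⊹a'∈F → a≢a' (Aᵢ-unique ha (a∈A , HAᵢ-refl a)
                                  (a'∈A , a ⊹ a' , inj₁ a⊹a'∈F , x⊹y≡z⇒y≡x⊹z refl))
    where
    Φ[a⊹a'] : Φ (a ⊹ a') false false
    Φ[a⊹a'] = Φ-⊹ ha ha'

  A⊕A-intro : ∀ {x a} → x ≢ 0v → A a → A (a ⊹ x) → (A ⊕ A) x
  A⊕A-intro {x} {a} x≢0 a∈A a⊹x∈A =
    a , a ⊹ x , a∈A , a⊹x∈A , x≢0⇒y≢y⊹x x≢0 a , sym (x⊹[x⊹y]≡y a x)

  H∞∖F⊆A⊕A : IsCompleteCap S → ∀ {x} → H∞ x × ¬ F x → (A ⊕ A) x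
  H∞∖F⊆A⊕A complete {x} (x∈H∞@(ux , vx , x≢0) , x∉F)
    with complete⇒secant complete x≢0 (λ x∈S → S∩H∞≡∅ x x∈S x∈H∞)
  ... | s , s∈S , s⊹x∈S with position s
  ...   | in-H∞∪0 (us , vs) = contradiction (us , vs , proj₁ capS s s∈S) (S∩H∞≡∅ s s∈S)
  ...   | in-HA hs = A⊕A-intro x≢0 (s∈S , hs) (s⊹x∈S , Φ-⊹ hs (ux , vx))
  ...   | in-HB hs = A⊕A-intro x≢0 (c₀⊹B⊆A (s∈S , hs))
                       (subst A (sym (⊹-assoc c₀ s x)) (c₀⊹B⊆A (s⊹x∈S , Φ-⊹ hs (ux , vx))))
  ...   | in-HC hs = contradiction ((x∈SpanC , x≢0) , x∈H∞) x∉F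
    where
    x∈SpanC : Span C x
    x∈SpanC = subst (Span C) (x⊹[x⊹y]≡y s x)
                (span-add (span-inc (s∈S , hs)) (span-inc (s⊹x∈S , Φ-⊹ hs (ux , vx))))

  F⇒¬OffSecants : ∀ {k y} → HasDim (Span C) (suc (suc k)) → F y → ¬ OffSecants S y
  F⇒¬OffSecants {y = y} dimC ((y∈SpanC , _) , uy , vy , y≢0) off =
    HasDim-¬⊆pair dimC (Span-⊆-pair C≡y⊹c₀)
    where
    C≡y⊹c₀ : ∀ {c} → C c → c ≡ y ⊹ c₀
    C≡y⊹c₀ {c} c∈C@(c∈S , hc) = x⊹y≡z⇒y≡x⊹z (trans (⊹-comm y c) c⊹y≡c₀)
      where
      c⊹y∈HC : HC (c ⊹ y)
      c⊹y∈HC = Φ-⊹ hc (uy , vy)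
      c⊹y≡c₀ : c ⊹ y ≡ c₀
      c⊹y≡c₀ = Equivalence.to (Ĉ∖C≡c₀ (c ⊹ y))
        (((span-add (span-inc c∈C) y∈SpanC , HC⇒≢0 c⊹y∈HC) , HC⇒∉F c⊹y∈HC) ,
         λ (c⊹y∈S , _) → off c (c ⊹ y) c∈S c⊹y∈S (x≢0⇒y≢y⊹x y≢0 c) (x⊹[x⊹y]≡y c y))

  SpanC∩HC∖S⊆c₀ : ∀ {y} → Span C y → HC y → ¬ y ∈ S → y ≡ c₀
  SpanC∩HC∖S⊆c₀ {y} y∈SpanC hy y∉S =
    Equivalence.to (Ĉ∖C≡c₀ y) (((y∈SpanC , HC⇒≢0 hy) , HC⇒∉F hy) , y∉S ∘ proj₁)

  c₀-on-secant : ∃ HA → ¬ OffSecants S c₀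
  c₀-on-secant (a , ha) with Aᵢ-inhabited ha
  ... | e , e∈A@(_ , he) , _ = ⊕⇒¬OffSecants {P = B} {Q = A} proj₁ proj₁
    (c₀ ⊹ e , e , c₀⊹A⊆B e∈A , e∈A , HB-HA-distinct (proj₂ (c₀⊹A⊆B e∈A)) he , sym ([x⊹y]⊹y≡x c₀ e))

  HA∖S-on-secant : ∀ {y} → HA y → ¬ y ∈ S → ¬ OffSecants S y
  HA∖S-on-secant {y} hy y∉S = ⊕⇒¬OffSecants (proj₁ ∘ proj₁) proj₁
    (Equivalence.from (Bᵢ⊕C⇔A'ᵢ hy y) (HAᵢ-refl y , y∉S ∘ proj₁))

  HB∖S-on-secant : ∀ {y} → HB y → ¬ y ∈ S → ¬ OffSecants S y
  HB∖S-on-secant {y} hy y∉S = ⊕⇒¬OffSecants (proj₁ ∘ proj₁) proj₁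
    (Equivalence.from (Aᵢ⊕C⇔B'ᵢ (Φ-⊹ c₀∈HC hy) y)
      ((c₀ ⊹ y , HAᵢ-refl (c₀ ⊹ y) , sym (x⊹[x⊹y]≡y c₀ y)) , y∉S ∘ proj₁))

  HC∖SpanC-on-secant : (∀ x → (A ⊕ A) x ⇔ (H∞ x × ¬ F x)) →
    ∀ {y} → HC y → ¬ Span C y → ¬ OffSecants S y
  HC∖SpanC-on-secant A⊕A≡H∞∖F {y} hy y∉SpanC
    with Equivalence.from (A⊕A≡H∞∖F (c₀ ⊹ y)) ((proj₁ Φz , proj₂ Φz , z≢0) , z∉F)
    where
    Φz : Φ (c₀ ⊹ y) false false
    Φz = Φ-⊹ c₀∈HC hy
    z≢0 : c₀ ⊹ y ≢ 0v
    z≢0 z≡0 = y∉SpanC (subst (Span C) (x⊹y≡0⇒x≡y z≡0) c₀∈SpanC)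
    z∉F : ¬ F (c₀ ⊹ y)
    z∉F ((z∈SpanC , _) , _) = y∉SpanC (subst (Span C) (x⊹[x⊹y]≡y c₀ y) (span-add c₀∈SpanC z∈SpanC))
  ... | a , a' , a∈A , a'∈A@(_ , ha') , _ , c₀⊹y≡a⊹a' = ⊕⇒¬OffSecants {P = B} {Q = A} proj₁ proj₁
    (c₀ ⊹ a , a' , c₀⊹A⊆B a∈A , a'∈A , HB-HA-distinct (proj₂ (c₀⊹A⊆B a∈A)) ha' , sym sum≡y)
    where
    sum≡y : (c₀ ⊹ a) ⊹ a' ≡ y
    sum≡y = begin
      (c₀ ⊹ a) ⊹ a'  ≡⟨ ⊹-assoc c₀ a a' ⟩
      c₀ ⊹ (a ⊹ a')  ≡⟨ cong (c₀ ⊹_) c₀⊹y≡a⊹a' ⟨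
      c₀ ⊹ (c₀ ⊹ y)  ≡⟨ x⊹[x⊹y]≡y c₀ y ⟩
      y              ∎
      where open ≡-Reasoning

  -- F y and Span C y need not be decidable, but the goal is ⊥, so we may still split on them.
  secants-cover : (∀ x → (A ⊕ A) x ⇔ (H∞ x × ¬ F x)) → ∃ HA → ∀ {k} → HasDim (Span C) (suc (suc k)) →
    ∀ y → y ≢ 0v → ¬ y ∈ S → ¬ OffSecants S y
  secants-cover A⊕A≡H∞∖F HA≢∅ dimC y y≢0 y∉S off with position y
  ... | in-HA hy = HA∖S-on-secant hy y∉S off
  ... | in-HB hy = HB∖S-on-secant hy y∉S off
  ... | in-H∞∪0 (uy , vy) = ¬¬-excluded-middle λ where
    (yes y∈F) → F⇒¬OffSecants dimC y∈F off
    (no y∉F)  → ⊕⇒¬OffSecants proj₁ proj₁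
                  (Equivalence.from (A⊕A≡H∞∖F y) ((uy , vy , y≢0) , y∉F)) off
  ... | in-HC hy = ¬¬-excluded-middle λ where
    (yes y∈SpanC) → c₀-on-secant HA≢∅ (subst (OffSecants S) (SpanC∩HC∖S⊆c₀ y∈SpanC hy y∉S) off)
    (no y∉SpanC)  → HC∖SpanC-on-secant A⊕A≡H∞∖F hy y∉SpanC off

lemma5p1 : (n r : ℕ) (u₁ u₂ : Vect n) (S : Vect n → Bool) (c₀ : Vect n) →
    u₁ ≢ 0v → u₂ ≢ 0v → u₁ ≢ u₂ →
    IsCap S →
    (∀ x → x ∈ S → ¬ Setting.H∞ u₁ u₂ S c₀ x) →
    (∃ λ x → Setting.C u₁ u₂ S c₀ x) →
    HasDim (Span (Setting.C u₁ u₂ S c₀)) (suc r) →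
    2 ≤ r → r ≤ n ∸ 1 →
    (∀ x → (Setting.Ĉ u₁ u₂ S c₀ x × ¬ Setting.C u₁ u₂ S c₀ x) ⇔ (x ≡ c₀)) →
    (∀ a → Setting.HA u₁ u₂ S c₀ a →
       (∀ x → (Setting.Aᵢ u₁ u₂ S c₀ a ⊕ Setting.C u₁ u₂ S c₀) x ⇔ Setting.B'ᵢ u₁ u₂ S c₀ a x)
       × (∀ x → (Setting.Bᵢ u₁ u₂ S c₀ a ⊕ Setting.C u₁ u₂ S c₀) x ⇔ Setting.A'ᵢ u₁ u₂ S c₀ a x)
       × ExactlyOne (Setting.Aᵢ u₁ u₂ S c₀ a)
       × ExactlyOne (Setting.Bᵢ u₁ u₂ S c₀ a)) →
    IsCompleteCap S ⇔
      (∀ x → (Setting.A u₁ u₂ S c₀ ⊕ Setting.A u₁ u₂ S c₀) x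
               ⇔ (Setting.H∞ u₁ u₂ S c₀ x × ¬ Setting.F u₁ u₂ S c₀ x))
lemma5p1 n r u₁ u₂ S c₀ u₁≢0 _ u₁≢u₂ capS S∩H∞≡∅ _ dimC (s≤s _) _ Ĉ∖C≡c₀ cosets =
  mk⇔ (λ complete x → mk⇔ A⊕A⊆H∞∖F (H∞∖F⊆A⊕A complete))
      (λ A⊕A≡H∞∖F → secants⇒complete capS
         (secants-cover A⊕A≡H∞∖F (dot-separates u₁ u₂ u₁≢0 u₁≢u₂) dimC))
  where open Configuration u₁ u₂ S c₀ capS S∩H∞≡∅ Ĉ∖C≡c₀ cosets
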